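{- Let $A,B$ be sets and $R\subseteq A\times B$ a relation. The axiom of choice instance $\mathsf{AC}_{ABR}$ — "if $\forall a\in A\,\exists b\in B\,R(a,b)$ then there is $\alpha:A\to B$ with $\forall a\,R(a,\alpha(a))$" — is logically equivalent to $\mathsf{GDC}_{ABR_{\top}}$: "if $R_{\top}$ is $A$-$B$-approximable then $R_{\top}$ has an $A$-$B$-choice function".
   Context: $(A\times B)^*$ is the set of finite sequences $v$ of pairs, $\langle\rangle$ empty, $v\star(a,b)$ extension; $v\subseteq v'$ means every pair in $v$ occurs in $v'$; $\mathrm{dom}(v)=\{a\mid\exists b,(a,b)\text{ occurs in }v\}$. The positive alignment of $R$ is the predicate $R_{\top}=\{v\in(A\times B)^*\mid R(a,b)\text{ for every pair }(a,b)\text{ occurring in }v\}$. For $T\subseteq(A\times B)^*$, $T^{\downarrow}=\{v\mid\forall v'\subseteq v,\ v'\in T\}$; $T$ is $A$-$B$-approximable if $\langle\rangle$ belongs to the greatest $X$ such that $X(v)$ implies $v\in T^{\downarrow}$ and $\forall a\notin\mathrm{dom}(v)\,\exists b\,X(v\star(a,b))$. For $\alpha:A\to B$, $v\prec\alpha$ means $\alpha(a)=b$ for all $(a,b)$ in $v$; $T$ has an $A$-$B$-choice function if $\exists\alpha:A\to B\,\forall v\,(v\prec\alpha\Rightarrow v\in T)$. -}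

module Defs where

open import Level using (Level; _⊔_; suc)
open import Data.Product using (Σ; ∃; ∃-syntax; _×_; _,_)
open import Data.List using (List; []; _∷ʳ_)
open import Data.List.Membership.Propositional using (_∈_)
open import Relation.Binary.PropositionalEquality using (_≡_)
open import Relation.Nullary using (¬_)

private
  variable
    a b r t : Level

-- (A × B)^* : finite sequences of pairs; ⟨⟩ = [], v ⋆ (a , b) = v ∷ʳ (a , b)
Seq : Set a → Set b → Set (a ⊔ b)
Seq A B = List (A × B)

module _ {A : Set a} {B : Set b} where

  _⊆ₛ_ : Seq A B → Seq A B → Set (a ⊔ b)
  v ⊆ₛ v' = ∀ {p} → p ∈ v → p ∈ v'

  _∈dom_ : A → Seq A B → Set (a ⊔ b)
  x ∈dom v = ∃[ y ] ((x , y) ∈ v)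

  Align⊤ : (A → B → Set r) → Seq A B → Set (a ⊔ b ⊔ r)
  Align⊤ R v = ∀ {x y} → (x , y) ∈ v → R x y

  Down : (Seq A B → Set t) → Seq A B → Set (a ⊔ b ⊔ t)
  Down T v = ∀ v' → v' ⊆ₛ v → T v'

  -- X is a post-fixed point of the operator defining approximability
  IsApproxPost : (Seq A B → Set t) → (Seq A B → Set (a ⊔ b ⊔ t)) → Set (a ⊔ b ⊔ t)
  IsApproxPost T X = ∀ v → X v →
    Down T v × (∀ x → ¬ (x ∈dom v) → ∃[ y ] X (v ∷ʳ (x , y)))

  -- T is A-B-approximable: ⟨⟩ lies in the greatest such X, i.e. (by
  -- Knaster–Tarski / coinduction) in some post-fixed point X.
  Approximable : (Seq A B → Set t) → Set (suc (a ⊔ b ⊔ t))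
  Approximable {t = t} T = Σ (Seq A B → Set (a ⊔ b ⊔ t)) (λ X → IsApproxPost {t = t} T X × X [])

  _≺_ : Seq A B → (A → B) → Set (a ⊔ b)
  v ≺ α = ∀ {x y} → (x , y) ∈ v → α x ≡ y

  HasChoiceFunction : (Seq A B → Set t) → Set (a ⊔ b ⊔ t)
  HasChoiceFunction T = Σ (A → B) (λ α → ∀ v → v ≺ α → T v)

AC : (A : Set a) (B : Set b) → (A → B → Set r) → Set (a ⊔ b ⊔ r)
AC A B R = (∀ x → ∃[ y ] R x y) → Σ (A → B) (λ α → ∀ x → R x (α x))

GDC : (A : Set a) (B : Set b) → (List (A × B) → Set t) → Set (suc (a ⊔ b ⊔ t))
GDC A B T = Approximable T → HasChoiceFunction T

module Submission where

-- If R_⊤ is approximable, extending the empty sequence once shows that R is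
-- total, so AC yields α with R(a, α a), and then every v ≺ α lies in R_⊤.
-- Conversely, if R is total then R_⊤ itself witnesses the approximability of
-- R_⊤: it is closed under subsequences and can be extended at every point.
-- A choice function α for R_⊤ then chooses in R, since [(a, α a)] ≺ α.

open import Defs
open import Level using (Level)
open import Function.Bundles using (_⇔_; mk⇔)
open import Data.Product using (∃-syntax; _,_; proj₁; proj₂)
open import Data.Sum using (inj₁; inj₂)
open import Data.List using ([]; _∷_; _∷ʳ_)
open import Data.List.Relation.Unary.Any using (here)
open import Data.List.Membership.Propositional.Properties using (∈-++⁻)
open import Relation.Binary.PropositionalEquality using (refl; subst)

module _ {a b t : Level} {A : Set a} {B : Set b} where

  approximable⇒singleton : (T : Seq A B → Set t) → Approximable T →
                           ∀ x → ∃[ y ] T ((x , y) ∷ [])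
  approximable⇒singleton T (X , post , X[]) x
    with proj₂ (post [] X[]) x (λ ())
  ... | y , X[xy] = y , proj₁ (post _ X[xy]) _ (λ p∈ → p∈)

singleton≺ : ∀ {a b} {A : Set a} {B : Set b} (α : A → B) (x : A) →
             ((x , α x) ∷ []) ≺ α
singleton≺ α x (here refl) = refl

module _ {a b r : Level} {A : Set a} {B : Set b} (R : A → B → Set r) where

  Align⊤-singleton⁻ : ∀ {x y} → Align⊤ R ((x , y) ∷ []) → R x y
  Align⊤-singleton⁻ R[xy] = R[xy] (here refl)

  Align⊤-∷ʳ⁺ : ∀ {v x y} → Align⊤ R v → R x y → Align⊤ R (v ∷ʳ (x , y))
  Align⊤-∷ʳ⁺ {v} Rv Rxy p∈ with ∈-++⁻ v p∈
  ... | inj₁ p∈v        = Rv p∈v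
  ... | inj₂ (here refl) = Rxy

  Align⊤-down : ∀ {v} → Align⊤ R v → Down (Align⊤ R) v
  Align⊤-down Rv _ v'⊆v p∈v' = Rv (v'⊆v p∈v')

  Align⊤-graph : ∀ {α} → (∀ x → R x (α x)) → ∀ v → v ≺ α → Align⊤ R v
  Align⊤-graph {α} Rα v v≺α {x} p∈ = subst (R x) (v≺α p∈) (Rα x)

  Align⊤-approximable⇒total : Approximable (Align⊤ R) → ∀ x → ∃[ y ] R x y
  Align⊤-approximable⇒total approx x
    with approximable⇒singleton (Align⊤ R) approx x
  ... | y , R[xy] = y , Align⊤-singleton⁻ R[xy]

  total⇒Align⊤-approximable : (∀ x → ∃[ y ] R x y) → Approximable (Align⊤ R)
  total⇒Align⊤-approximable total = Align⊤ R , post , λ ()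
    where
    post : IsApproxPost (Align⊤ R) (Align⊤ R)
    post v Rv = Align⊤-down Rv
              , λ x _ → proj₁ (total x) , Align⊤-∷ʳ⁺ Rv (proj₂ (total x))

theorem7 : ∀ {a b r : Level} (A : Set a) (B : Set b) (R : A → B → Set r) →
    AC A B R ⇔ GDC A B (Align⊤ R)
theorem7 A B R = mk⇔ ac⇒gdc gdc⇒ac
  where
  ac⇒gdc : AC A B R → GDC A B (Align⊤ R)
  ac⇒gdc ac approx with ac (Align⊤-approximable⇒total R approx)
  ... | α , Rα = α , Align⊤-graph R Rα

  gdc⇒ac : GDC A B (Align⊤ R) → AC A B R
  gdc⇒ac gdc total with gdc (total⇒Align⊤-approximable R total)
  ... | α , choice =
    α , λ x → Align⊤-singleton⁻ R (choice ((x , α x) ∷ []) (singleton≺ α x))
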